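{- $BR_6(K_{2,2},K_{4,4})=BR_7(K_{2,2},K_{4,4})=22$.
   Context: For bipartite graphs $H_1,H_2$ and a positive integer $m$, $BR_m(H_1,H_2)$ is the least positive integer $n$ such that for every subgraph $G$ of $K_{m,n}$ (parts of sizes $m$ and $n$), either $G$ contains a copy of $H_1$ or the bipartite complement $\overline{G}=K_{m,n}-E(G)$ contains a copy of $H_2$. -}

module Defs where

open import Data.Nat using (ℕ; _≤_; _<_)
open import Data.Fin using (Fin)
open import Data.Bool using (Bool; true; not)
open import Data.Product using (Σ; _×_)
open import Data.Sum using (_⊎_)
open import Relation.Binary.PropositionalEquality using (_≡_)
open import Relation.Nullary using (¬_)
open import Function.Definitions using (Injective)

-- A subgraph of K_{m,n}: parts Fin m and Fin n, G i j ≡ true iff ij is an edge.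
BipGraph : ℕ → ℕ → Set
BipGraph m n = Fin m → Fin n → Bool

bcomp : ∀ {m n} → BipGraph m n → BipGraph m n
bcomp G i j = not (G i j)

ContainsKOriented : ∀ {m n} → ℕ → ℕ → BipGraph m n → Set
ContainsKOriented {m} {n} s t G =
  Σ (Fin s → Fin m) λ f → Σ (Fin t → Fin n) λ g →
    Injective _≡_ _≡_ f × Injective _≡_ _≡_ g × (∀ i j → G (f i) (g j) ≡ true)

ContainsK : ∀ {m n} → ℕ → ℕ → BipGraph m n → Set
ContainsK s t G = ContainsKOriented s t G ⊎ ContainsKOriented t s G

BRProp : ℕ → ℕ → ℕ → ℕ → ℕ → ℕ → Set
BRProp m s₁ t₁ s₂ t₂ n =
  (G : BipGraph m n) → ContainsK s₁ t₁ G ⊎ ContainsK s₂ t₂ (bcomp G)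

IsBR : ℕ → ℕ → ℕ → ℕ → ℕ → ℕ → Set
IsBR m s₁ t₁ s₂ t₂ n =
  1 ≤ n × BRProp m s₁ t₁ s₂ t₂ n ×
  (∀ n′ → 1 ≤ n′ → n′ < n → ¬ BRProp m s₁ t₁ s₂ t₂ n′)

-- Index the ordered pairs of distinct rows of K₆,ₙ by (a , b), and give a column j
-- weight 4 for each pair it is joined to completely plus 1 for each pair whose four complementary
-- rows it avoids completely.  Each of the 64 possible columns has weight at least 10, so for n = 22
-- the total weight is at least 220.  Summing over pairs instead: without a K₂,₂ in G every pair has
-- at most one common neighbour, and without a K₄,₄ in the complement every four rows have at most
-- three common non-neighbours, so the total is at most 30 · (4 + 3) = 210.  Extra rows only help,
-- which gives m = 7.
-- Lower bound.  In the vertex–edge incidence graph of K₇ (7 × 21) two vertices lie on one common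
-- edge and only three edges avoid four given vertices; its restrictions to at most 7 rows and fewer
-- than 22 columns are counterexamples.

module Submission where

open import Data.Bool using (true; false; _∨_; not)
open import Data.Bool.Properties using () renaming (_≟_ to _≟ᵇ_)
open import Data.Empty using (⊥; ⊥-elim)
open import Data.Fin using (Fin; zero; suc; #_; punchIn; punchOut; inject≤; lift)
open import Data.Fin.Properties
  using (_≟_; any?; all?; injective⇒≤; suc-injective; punchIn-injective; punchInᵢ≢i;
         punchOut-injective; punchIn-punchOut; inject≤-injective; lift-injective)
open import Data.Fin.Subset using (Subset)
open import Data.Fin.Subset.Properties using (anySubset?)
open import Data.Nat using (ℕ; zero; suc; _+_; _*_; _≤_; _<_; z≤n; s≤s; s≤s⁻¹; _≤?_)
open import Data.Nat.Properties
  using (+-*-semiring; ≤-trans; ≤-refl; m≤n+m; +-mono-≤; *-monoʳ-≤; ≰⇒>; ≤⇒≤ᵇ; n≤1+n;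
         module ≤-Reasoning)
open import Algebra.Properties.Semiring.Sum +-*-semiring
  using (sum; sum-syntax; ∑-comm; ∑-distrib-+; *-distribˡ-sum; sum-cong-≗)
open import Data.Product using (_×_; _,_; Σ; ∃; proj₁; proj₂)
open import Data.Sum using (_⊎_; inj₁; inj₂; [_,_])
import Data.Sum as Sum
open import Data.Vec using (Vec; []; _∷_; lookup; tabulate)
open import Data.Vec.Properties using (lookup∘tabulate)
import Data.Vec.Functional as Vector
open import Defs
open import Function using (_∘_; _⇔_; mk⇔; Equivalence)
open import Function.Definitions using (Injective)
open import Level using (Level)
open import Relation.Binary.PropositionalEquality
  using (_≡_; _≢_; refl; sym; trans; cong; cong₂; subst; module ≡-Reasoning)
open import Relation.Nullary
  using (¬_; contradiction; Dec; yes; no; does; _because_; ¬?; _×-dec_; _→-dec_)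
open import Relation.Nullary.Decidable using (map′; from-no; decidable-stable)
open import Relation.Unary using (Pred; Decidable)

private
  variable
    p : Level
    k m m′ n n′ s t : ℕ

indicator : ∀ {A : Set p} → Dec A → ℕ
indicator (true because _) = 1
indicator (false because _) = 0

count : {P : Pred (Fin n) p} → Decidable P → ℕ
count {n} P? = ∑[ i < n ] indicator (P? i)

sum-mono-≤ : {f g : Fin n → ℕ} → (∀ i → f i ≤ g i) → sum f ≤ sum g
sum-mono-≤ {zero} _ = z≤n
sum-mono-≤ {suc n} f≤g = +-mono-≤ (f≤g zero) (sum-mono-≤ (f≤g ∘ suc))

indicator-yes : ∀ {A : Set p} (A? : Dec A) → A → indicator A? ≡ 1
indicator-yes (yes _) _ = refl
indicator-yes (no ¬a) a = contradiction a ¬a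

indicator-⇔ : ∀ {A B : Set p} → A ⇔ B → (A? : Dec A) (B? : Dec B) → indicator A? ≡ indicator B?
indicator-⇔ _   (yes _) (yes _)  = refl
indicator-⇔ A⇔B (yes a) (no ¬b) = contradiction (Equivalence.to A⇔B a) ¬b
indicator-⇔ A⇔B (no ¬a) (yes b) = contradiction (Equivalence.from A⇔B b) ¬a
indicator-⇔ _   (no _)  (no _)   = refl

factor-through-suc : {f : Fin k → Fin (suc n)} → Injective _≡_ _≡_ f → (∀ i → f i ≢ zero) →
  Σ (Fin k → Fin n) λ g → Injective _≡_ _≡_ g × (∀ i → suc (g i) ≡ f i)
factor-through-suc {f = f} inj f≢0 =
  (λ i → punchOut (0≢f i)) , inj ∘ punchOut-injective (0≢f _) (0≢f _) , λ i → punchIn-punchOut (0≢f i)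
  where
  0≢f : ∀ i → zero ≢ f i
  0≢f i = f≢0 i ∘ sym

injection⇒≤count : {P : Pred (Fin n) p} (P? : Decidable P) {f : Fin k → Fin n} →
  Injective _≡_ _≡_ f → (∀ i → P (f i)) → k ≤ count P?
injection⇒≤count {n = zero} P? inj Pf = injective⇒≤ inj
injection⇒≤count {n = suc n} {k = zero} P? inj Pf = z≤n
injection⇒≤count {n = suc n} {k = suc k} {P = P} P? {f} inj Pf with any? (λ i → f i ≟ zero)
... | no f≢0 =
  let g , g-inj , sg≡f = factor-through-suc inj (λ i fi≡0 → f≢0 (i , fi≡0)) in
  ≤-trans (injection⇒≤count (P? ∘ suc) g-inj (λ i → subst P (sym (sg≡f i)) (Pf i)))
          (m≤n+m _ (indicator (P? zero)))
... | yes (i₀ , fi₀≡0) =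
  let g , g-inj , sg≡f = factor-through-suc (punchIn-injective i₀ _ _ ∘ inj) f∘punchIn≢0 in
  begin
    suc k
      ≤⟨ s≤s (injection⇒≤count (P? ∘ suc) g-inj (λ i → subst P (sym (sg≡f i)) (Pf _))) ⟩
    1 + count (P? ∘ suc)
      ≡⟨ cong (_+ count (P? ∘ suc)) (indicator-yes (P? zero) (subst P fi₀≡0 (Pf i₀))) ⟨
    indicator (P? zero) + count (P? ∘ suc) ∎
  where
  open ≤-Reasoning
  f∘punchIn≢0 : ∀ i → f (punchIn i₀ i) ≢ zero
  f∘punchIn≢0 i fi≡0 = punchInᵢ≢i i₀ i (inj (trans fi≡0 (sym fi₀≡0)))

≤count⇒injection : {P : Pred (Fin n) p} (P? : Decidable P) → k ≤ count P? →
  Σ (Fin k → Fin n) λ f → Injective _≡_ _≡_ f × (∀ i → P (f i))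
≤count⇒injection {k = zero} P? _ = (λ ()) , (λ { {()} }) , (λ ())
≤count⇒injection {n = suc n} {k = suc k} P? k≤count with P? zero
... | yes P0 =
  let f , f-inj , Pf = ≤count⇒injection (P? ∘ suc) (s≤s⁻¹ k≤count) in
  lift 1 f , lift-injective f f-inj 1 , λ { zero → P0 ; (suc i) → Pf i }
... | no _ =
  let f , f-inj , Pf = ≤count⇒injection (P? ∘ suc) k≤count in
  suc ∘ f , f-inj ∘ suc-injective , Pf

anyVec? : {P : Pred (Vec (Fin m) s) p} → Decidable P → Dec (∃ P)
anyVec? {s = zero} P? = map′ ([] ,_) (λ { ([] , Pv) → Pv }) (P? [])
anyVec? {s = suc s} P? =
  map′ (λ (x , v , Pxv) → x ∷ v , Pxv) (λ { (x ∷ v , Pxv) → x , v , Pxv })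
       (any? λ x → anyVec? λ v → P? (x ∷ v))

injective? : (f : Fin m → Fin n) → Dec (Injective _≡_ _≡_ f)
injective? f = map′ (λ inj {x} {y} → inj x y) (λ inj x y → inj)
  (all? λ x → all? λ y → (f x ≟ f y) →-dec (x ≟ y))

commonNeighbour? : (G : BipGraph m n) (f : Fin s → Fin m) → Decidable (λ j → ∀ i → G (f i) j ≡ true)
commonNeighbour? G f j = all? λ i → G (f i) j ≟ᵇ true

codegree : BipGraph m n → (Fin s → Fin m) → ℕ
codegree G f = count (commonNeighbour? G f)

containsKOriented-of-codegree : (G : BipGraph m n) {f : Fin s → Fin m} → Injective _≡_ _≡_ f →
  t ≤ codegree G f → ContainsKOriented s t G
containsKOriented-of-codegree G {f} f-inj t≤ =
  let g , g-inj , common = ≤count⇒injection (commonNeighbour? G f) t≤ in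
  f , g , f-inj , g-inj , λ i j → common j i

containsKOriented? : ∀ s t (G : BipGraph m n) → Dec (ContainsKOriented s t G)
containsKOriented? s t G =
  map′ (λ (v , inj , t≤) → containsKOriented-of-codegree G inj t≤) rowVector
       (anyVec? λ v → injective? (lookup v) ×-dec (t ≤? codegree G (lookup v)))
  where
  rowVector : ContainsKOriented s t G → ∃ λ v → Injective _≡_ _≡_ (lookup v) × t ≤ codegree G (lookup v)
  rowVector (f , g , f-inj , g-inj , edge) =
    tabulate f ,
    (λ {x} {y} eq → f-inj (trans (sym (lookup∘tabulate f x)) (trans eq (lookup∘tabulate f y)))) ,
    injection⇒≤count (commonNeighbour? G _) g-inj
      (λ j i → trans (cong (λ r → G r (g j)) (lookup∘tabulate f i)) (edge i j))

restrict : BipGraph m n → m′ ≤ m → n′ ≤ n → BipGraph m′ n′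
restrict G m′≤m n′≤n i j = G (inject≤ i m′≤m) (inject≤ j n′≤n)

containsK-restrict : (G : BipGraph m n) (m′≤m : m′ ≤ m) (n′≤n : n′ ≤ n) →
  ContainsK s t (restrict G m′≤m n′≤n) → ContainsK s t G
containsK-restrict G m′≤m n′≤n = Sum.map compose compose
  where
  compose : ∀ {s t} → ContainsKOriented s t (restrict G m′≤m n′≤n) → ContainsKOriented s t G
  compose (f , g , f-inj , g-inj , edge) =
    (λ x → inject≤ (f x) m′≤m) , (λ y → inject≤ (g y) n′≤n) ,
    f-inj ∘ inject≤-injective m′≤m m′≤m _ _ , g-inj ∘ inject≤-injective n′≤n n′≤n _ _ , edge

BRProp-mono-rows : ∀ {s₁ t₁ s₂ t₂} → m ≤ m′ → BRProp m s₁ t₁ s₂ t₂ n → BRProp m′ s₁ t₁ s₂ t₂ n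
BRProp-mono-rows m≤m′ br G =
  Sum.map (containsK-restrict G m≤m′ ≤-refl) (containsK-restrict (bcomp G) m≤m′ ≤-refl)
          (br (restrict G m≤m′ ≤-refl))

¬BRProp-of-counterexample : ∀ {s₁ t₁ s₂ t₂} (G : BipGraph m n) →
  ¬ ContainsK s₁ t₁ G → ¬ ContainsK s₂ t₂ (bcomp G) → m′ ≤ m → n′ ≤ n → ¬ BRProp m′ s₁ t₁ s₂ t₂ n′
¬BRProp-of-counterexample G no₁ no₂ m′≤m n′≤n br =
  [ no₁ ∘ containsK-restrict G m′≤m n′≤n , no₂ ∘ containsK-restrict (bcomp G) m′≤m n′≤n ]
    (br (restrict G m′≤m n′≤n))

-- (a , b) indexes the ordered pair of distinct rows a, punchIn a b; others a b are the remaining rows.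
pair : Fin (suc n) → Fin n → Fin 2 → Fin (suc n)
pair a b = a Vector.∷ punchIn a b Vector.∷ Vector.[]

pair-injective : (a : Fin (suc n)) (b : Fin n) → Injective _≡_ _≡_ (pair a b)
pair-injective a b {zero}     {zero}     _   = refl
pair-injective a b {zero}     {suc zero} a≡ = contradiction (sym a≡) (punchInᵢ≢i a b)
pair-injective a b {suc zero} {zero}     ≡a = contradiction ≡a (punchInᵢ≢i a b)
pair-injective a b {suc zero} {suc zero} _   = refl

others : Fin (suc (suc n)) → Fin (suc n) → Fin n → Fin (suc (suc n))
others a b = punchIn a ∘ punchIn b

others-injective : (a : Fin (suc (suc n))) (b : Fin (suc n)) → Injective _≡_ _≡_ (others a b)
others-injective a b = punchIn-injective b _ _ ∘ punchIn-injective a _ _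

pairWeight : BipGraph (suc (suc k)) n → Fin n → Fin (suc (suc k)) → Fin (suc k) → ℕ
pairWeight G j a b =
  4 * indicator (commonNeighbour? G (pair a b) j) + indicator (commonNeighbour? (bcomp G) (others a b) j)

∑-pairs : (Fin (suc (suc k)) → Fin (suc k) → ℕ) → ℕ
∑-pairs {k} f = ∑[ a < suc (suc k) ] ∑[ b < suc k ] f a b

∑-pairs-mono-≤ : {f g : Fin (suc (suc k)) → Fin (suc k) → ℕ} →
  (∀ a b → f a b ≤ g a b) → ∑-pairs f ≤ ∑-pairs g
∑-pairs-mono-≤ f≤g = sum-mono-≤ (λ a → sum-mono-≤ (f≤g a))

∑-pairs-cong : {f g : Fin (suc (suc k)) → Fin (suc k) → ℕ} →
  (∀ a b → f a b ≡ g a b) → ∑-pairs f ≡ ∑-pairs g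
∑-pairs-cong f≡g = sum-cong-≗ (λ a → sum-cong-≗ (f≡g a))

weight : BipGraph (suc (suc k)) n → Fin n → ℕ
weight G j = ∑-pairs (pairWeight G j)

∑-weight : (G : BipGraph (suc (suc k)) n) →
  ∑[ j < n ] weight G j ≡ ∑-pairs (λ a b → 4 * codegree G (pair a b) + codegree (bcomp G) (others a b))
∑-weight {k} {n} G = begin
  ∑[ j < n ] ∑[ a < suc (suc k) ] ∑[ b < suc k ] pairWeight G j a b
    ≡⟨ ∑-comm (λ j a → ∑[ b < suc k ] pairWeight G j a b) ⟩
  ∑[ a < suc (suc k) ] ∑[ j < n ] ∑[ b < suc k ] pairWeight G j a b
    ≡⟨ sum-cong-≗ (λ a → ∑-comm (λ j b → pairWeight G j a b)) ⟩
  ∑[ a < suc (suc k) ] ∑[ b < suc k ] ∑[ j < n ] pairWeight G j a b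
    ≡⟨ sum-cong-≗ (λ a → sum-cong-≗ (λ b → ∑-pairWeight a b)) ⟩
  ∑[ a < suc (suc k) ] ∑[ b < suc k ] (4 * codegree G (pair a b) + codegree (bcomp G) (others a b)) ∎
  where
  open ≡-Reasoning
  ∑-pairWeight : ∀ a b →
    ∑[ j < n ] pairWeight G j a b ≡ 4 * codegree G (pair a b) + codegree (bcomp G) (others a b)
  ∑-pairWeight a b = begin
    ∑[ j < n ] pairWeight G j a b
      ≡⟨ ∑-distrib-+ (λ j → 4 * common j) (λ j → indicator (commonNeighbour? (bcomp G) (others a b) j)) ⟩
    ∑[ j < n ] (4 * common j) + codegree (bcomp G) (others a b)
      ≡⟨ cong (_+ codegree (bcomp G) (others a b)) (*-distribˡ-sum 4 common) ⟨
    4 * codegree G (pair a b) + codegree (bcomp G) (others a b) ∎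
    where
    common : Fin n → ℕ
    common j = indicator (commonNeighbour? G (pair a b) j)

commonNeighbour-cong : (G : BipGraph m n) (G′ : BipGraph m n′) {j : Fin n} {j′ : Fin n′} →
  (∀ i → G i j ≡ G′ i j′) → (f : Fin s → Fin m) →
  indicator (commonNeighbour? G f j) ≡ indicator (commonNeighbour? G′ f j′)
commonNeighbour-cong G G′ {j} {j′} col≡ f = indicator-⇔
  (mk⇔ (λ common i → trans (sym (col≡ (f i))) (common i)) (λ common i → trans (col≡ (f i)) (common i)))
  (commonNeighbour? G f j) (commonNeighbour? G′ f j′)

weight-cong : (G : BipGraph (suc (suc k)) n) (G′ : BipGraph (suc (suc k)) n′) {j : Fin n} {j′ : Fin n′} →
  (∀ i → G i j ≡ G′ i j′) → weight G j ≡ weight G′ j′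
weight-cong G G′ {j} {j′} col≡ = ∑-pairs-cong {f = pairWeight G j} {g = pairWeight G′ j′} λ a b →
  cong₂ (λ x y → 4 * x + y) (commonNeighbour-cong G G′ col≡ (pair a b))
    (commonNeighbour-cong (bcomp G) (bcomp G′) (cong not ∘ col≡) (others a b))

-- weight G j depends only on column j, so it suffices to check the 64 subsets of Fin 6.
weight-≥10 : (G : BipGraph 6 n) (j : Fin n) → 10 ≤ weight G j
weight-≥10 G j =
  subst (10 ≤_) (weight-cong (oneColumn column) G {zero} (lookup∘tabulate (λ i → G i j))) (on-subsets column)
  where
  column : Subset 6
  column = tabulate (λ i → G i j)
  oneColumn : Subset 6 → BipGraph 6 1
  oneColumn c i _ = lookup c i
  on-subsets : (c : Subset 6) → 10 ≤ weight (oneColumn c) zero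
  on-subsets c = decidable-stable (10 ≤? weight (oneColumn c) zero) λ w<10 →
    from-no (anySubset? λ c′ → ¬? (10 ≤? weight (oneColumn c′) zero)) (c , w<10)

∑-weight-≤ : (G : BipGraph (suc (suc k)) n) →
  (∀ a b → codegree G (pair a b) < 2) → (∀ a b → codegree (bcomp G) (others a b) < 4) →
  ∑[ j < n ] weight G j ≤ ∑-pairs {k} (λ _ _ → 7)
∑-weight-≤ {k} {n} G few-common few-avoided = begin
  ∑[ j < n ] weight G j
    ≡⟨ ∑-weight G ⟩
  ∑-pairs (λ a b → 4 * codegree G (pair a b) + codegree (bcomp G) (others a b))
    ≤⟨ ∑-pairs-mono-≤ (λ a b →
         +-mono-≤ (*-monoʳ-≤ 4 (s≤s⁻¹ (few-common a b))) (s≤s⁻¹ (few-avoided a b))) ⟩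
  ∑-pairs {k} (λ _ _ → 7) ∎
  where open ≤-Reasoning

small-codegrees⇒⊥ : (G : BipGraph 6 22) →
  (∀ a b → codegree G (pair a b) < 2) → (∀ a b → codegree (bcomp G) (others a b) < 4) → ⊥
-- The chain proves 220 ≤ 210, and T (220 ≤ᵇ 210) computes to ⊥.
small-codegrees⇒⊥ G few-common few-avoided = ≤⇒≤ᵇ (begin
  ∑[ j < 22 ] 10          ≤⟨ sum-mono-≤ (weight-≥10 G) ⟩
  ∑[ j < 22 ] weight G j  ≤⟨ ∑-weight-≤ G few-common few-avoided ⟩
  ∑-pairs {4} (λ _ _ → 7) ∎)
  where open ≤-Reasoning

BRProp-6-22 : BRProp 6 2 2 4 4 22
BRProp-6-22 G = decide (any? λ a → any? λ b → 2 ≤? codegree G (pair a b))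
                       (any? λ a → any? λ b → 4 ≤? codegree (bcomp G) (others a b))
  where
  decide : Dec (∃ λ a → ∃ λ b → 2 ≤ codegree G (pair a b)) →
           Dec (∃ λ a → ∃ λ b → 4 ≤ codegree (bcomp G) (others a b)) →
           ContainsK 2 2 G ⊎ ContainsK 4 4 (bcomp G)
  decide (yes (a , b , 2≤)) _ =
    inj₁ (inj₁ (containsKOriented-of-codegree G (pair-injective a b) 2≤))
  decide _ (yes (a , b , 4≤)) =
    inj₂ (inj₁ (containsKOriented-of-codegree (bcomp G) (others-injective a b) 4≤))
  decide (no few-common) (no few-avoided) = ⊥-elim (small-codegrees⇒⊥ G
    (λ a b → ≰⇒> λ 2≤ → few-common (a , b , 2≤)) (λ a b → ≰⇒> λ 4≤ → few-avoided (a , b , 4≤)))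

K₇-edges : Vec (Fin 7 × Fin 7) 21
K₇-edges =
  (# 0 , # 1) ∷ (# 0 , # 2) ∷ (# 0 , # 3) ∷ (# 0 , # 4) ∷ (# 0 , # 5) ∷ (# 0 , # 6) ∷
  (# 1 , # 2) ∷ (# 1 , # 3) ∷ (# 1 , # 4) ∷ (# 1 , # 5) ∷ (# 1 , # 6) ∷
  (# 2 , # 3) ∷ (# 2 , # 4) ∷ (# 2 , # 5) ∷ (# 2 , # 6) ∷
  (# 3 , # 4) ∷ (# 3 , # 5) ∷ (# 3 , # 6) ∷
  (# 4 , # 5) ∷ (# 4 , # 6) ∷
  (# 5 , # 6) ∷ []

K₇-incidence : BipGraph 7 21
K₇-incidence v e = does (v ≟ proj₁ (lookup K₇-edges e)) ∨ does (v ≟ proj₂ (lookup K₇-edges e))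

K₇-incidence-C₄-free : ¬ ContainsK 2 2 K₇-incidence
K₇-incidence-C₄-free = [ no-C₄ , no-C₄ ]
  where
  no-C₄ : ¬ ContainsKOriented 2 2 K₇-incidence
  no-C₄ = from-no (containsKOriented? 2 2 K₇-incidence)

K₇-incidence-complement-K₄₄-free : ¬ ContainsK 4 4 (bcomp K₇-incidence)
K₇-incidence-complement-K₄₄-free = [ no-K₄₄ , no-K₄₄ ]
  where
  no-K₄₄ : ¬ ContainsKOriented 4 4 (bcomp K₇-incidence)
  no-K₄₄ = from-no (containsKOriented? 4 4 (bcomp K₇-incidence))

theorem4 : IsBR 6 2 2 4 4 22 × IsBR 7 2 2 4 4 22
theorem4 =
  (s≤s z≤n , BRProp-6-22 , below (n≤1+n 6)) ,
  (s≤s z≤n , BRProp-mono-rows (n≤1+n 6) BRProp-6-22 , below ≤-refl)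
  where
  below : ∀ {m} → m ≤ 7 → ∀ n′ → 1 ≤ n′ → n′ < 22 → ¬ BRProp m 2 2 4 4 n′
  below m≤7 n′ _ n′<22 =
    ¬BRProp-of-counterexample K₇-incidence K₇-incidence-C₄-free K₇-incidence-complement-K₄₄-free
      m≤7 (s≤s⁻¹ n′<22)
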